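{- Let $G$ be a finite simple graph that is $\alpha$-excellent. Then no vertex of $G$ belongs to two (or more) distinct simplexes of $G$.
   Context: All graphs are finite and simple. For a graph $G$, $\alpha(G)$ denotes the independence number (maximum size of an independent set), and an $\alpha$-set is an independent set of size $\alpha(G)$. A graph $G$ is $\alpha$-excellent if every vertex of $G$ belongs to some $\alpha$-set of $G$. A vertex $v$ is simplicial if every two vertices of its open neighborhood $N_G(v)$ are adjacent. A clique is a maximal complete subgraph; a simplex of $G$ is a clique of $G$ containing at least one simplicial vertex of $G$ (if $v$ is simplicial, $G[N_G[v]]$ is the unique simplex containing $v$). -}

module Defs where

open import Data.Nat using (ℕ; _≤_)
open import Data.Fin using (Fin)
open import Data.Fin.Subset using (Subset; _∈_; _∉_; ∣_∣)
open import Data.Product using (Σ; _×_; ∃)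
open import Relation.Nullary using (¬_)
open import Relation.Binary.PropositionalEquality using (_≡_; _≢_)

record Graph (n : ℕ) : Set₁ where
  field
    Adj      : Fin n → Fin n → Set
    symmetric   : ∀ {u v} → Adj u v → Adj v u
    irreflexive : ∀ {u} → ¬ Adj u u

module _ {n : ℕ} (G : Graph n) where
  open Graph G

  Independent : Subset n → Set
  Independent S = ∀ u v → u ∈ S → v ∈ S → ¬ Adj u v

  IsAlphaSet : Subset n → Set
  IsAlphaSet S = Independent S × (∀ T → Independent T → ∣ T ∣ ≤ ∣ S ∣)

  AlphaExcellent : Set
  AlphaExcellent = ∀ v → Σ (Subset n) λ S → IsAlphaSet S × v ∈ S

  Complete : Subset n → Set
  Complete S = ∀ u v → u ∈ S → v ∈ S → u ≢ v → Adj u v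

  IsClique : Subset n → Set
  IsClique S = Complete S × (∀ w → w ∉ S → ¬ (∀ u → u ∈ S → Adj w u))

  Simplicial : Fin n → Set
  Simplicial v = ∀ u w → Adj v u → Adj v w → u ≢ w → Adj u w

  IsSimplex : Subset n → Set
  IsSimplex C = IsClique C × ∃ λ v → v ∈ C × Simplicial v

{-# OPTIONS --safe #-}
-- A clique containing a simplicial vertex s is exactly N[s], so two distinct simplexes
-- through v cannot share their simplicial vertices s₁, s₂: these are then distinct,
-- non-adjacent neighbours of v. In an α-set S ∋ v the only neighbour of a simplicial
-- neighbour of v is v itself, so (S − v) ∪ {s₁, s₂} is a larger independent set;
-- hence v lies in no α-set, contradicting α-excellence.
module Submission where

open import Defs
open import Data.Nat using (ℕ; suc; _<_)
open import Data.Nat.Properties using (≤-<-trans; ≤-trans; ≤-reflexive; <⇒≱)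
open import Data.Fin using (Fin; _≟_)
open import Data.Fin.Subset
  using (Subset; _∈_; _∉_; _⊆_; _⊂_; ∣_∣; inside; outside; _─_; _-_; _∪_; ⁅_⁆)
open import Data.Fin.Subset.Properties
  using ( _∈?_; ⊆-antisym; p⊆p∪q; q⊆p∪q; x∈p∪q⁻; x∈⁅x⁆; x∈⁅y⁆⇒x≡y
        ; p─q⊆p; p─⊥≡p; p⊂q⇒∣p∣<∣q∣ )
open import Data.Vec using (_∷_; here; there)
open import Data.Product using (_,_; proj₁)
open import Data.Sum using (inj₁; inj₂)
open import Function using (_∘_)
open import Relation.Nullary using (¬_; yes; no; contradiction)
open import Relation.Binary.PropositionalEquality
  using (_≡_; _≢_; refl; sym; cong; subst)

x∈p─q⇒x∉q : ∀ {n} {x : Fin n} {p q} → x ∈ p ─ q → x ∉ q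
x∈p─q⇒x∉q {p = _ ∷ _} {outside ∷ _} (there x∈p─q) (there x∈q) = x∈p─q⇒x∉q x∈p─q x∈q
x∈p─q⇒x∉q {p = _ ∷ _} {inside  ∷ _} (there x∈p─q) (there x∈q) = x∈p─q⇒x∉q x∈p─q x∈q

x∈p-y⇒x≢y : ∀ {n} {x y : Fin n} {p} → x ∈ p - y → x ≢ y
x∈p-y⇒x≢y x∈p-y refl = x∈p─q⇒x∉q x∈p-y (x∈⁅x⁆ _)

x∉p⇒p⊂p∪⁅x⁆ : ∀ {n} {x : Fin n} {p} → x ∉ p → p ⊂ p ∪ ⁅ x ⁆
x∉p⇒p⊂p∪⁅x⁆ {x = x} {p} x∉p = p⊆p∪q ⁅ x ⁆ , x , q⊆p∪q p ⁅ x ⁆ (x∈⁅x⁆ x) , x∉p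

x∈p⇒∣p∣≡suc∣p-x∣ : ∀ {n} {x : Fin n} {p} → x ∈ p → ∣ p ∣ ≡ suc ∣ p - x ∣
x∈p⇒∣p∣≡suc∣p-x∣ {p = inside ∷ p} here = cong (λ q → suc ∣ q ∣) (sym (p─⊥≡p p))
x∈p⇒∣p∣≡suc∣p-x∣ {p = inside  ∷ _} (there x∈p) = cong suc (x∈p⇒∣p∣≡suc∣p-x∣ x∈p)
x∈p⇒∣p∣≡suc∣p-x∣ {p = outside ∷ _} (there x∈p) = x∈p⇒∣p∣≡suc∣p-x∣ x∈p

module _ {n : ℕ} (G : Graph n) where
  open Graph G

  independent-⊆ : ∀ {S T} → S ⊆ T → Independent G T → Independent G S
  independent-⊆ S⊆T indT u w u∈S w∈S = indT u w (S⊆T u∈S) (S⊆T w∈S)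

  independent-∪-⁅⁆ : ∀ {S a} → Independent G S → (∀ {u} → u ∈ S → ¬ Adj a u) →
                     Independent G (S ∪ ⁅ a ⁆)
  independent-∪-⁅⁆ {S} {a} indS a≁S u w u∈ w∈
    with x∈p∪q⁻ S ⁅ a ⁆ u∈ | x∈p∪q⁻ S ⁅ a ⁆ w∈
  ... | inj₁ u∈S | inj₁ w∈S = indS u w u∈S w∈S
  ... | inj₁ u∈S | inj₂ w∈a rewrite x∈⁅y⁆⇒x≡y a w∈a = a≁S u∈S ∘ symmetric
  ... | inj₂ u∈a | inj₁ w∈S rewrite x∈⁅y⁆⇒x≡y a u∈a = a≁S w∈S
  ... | inj₂ u∈a | inj₂ w∈a rewrite x∈⁅y⁆⇒x≡y a u∈a | x∈⁅y⁆⇒x≡y a w∈a = irreflexive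

  simplicial-neighbour∈clique : ∀ {s C u} → Simplicial G s → IsClique G C → s ∈ C →
                                Adj s u → u ∈ C
  simplicial-neighbour∈clique {s} {C} {u} simp (complete , maximal) s∈C s~u with u ∈? C
  ... | yes u∈C = u∈C
  ... | no  u∉C = contradiction u~C (maximal u u∉C)
    where
    u~C : ∀ x → x ∈ C → Adj u x
    u~C x x∈C with x ≟ s
    ... | yes refl = symmetric s~u
    ... | no  x≢s  = simp u x s~u (complete s x s∈C x∈C (x≢s ∘ sym))
                       (λ u≡x → u∉C (subst (_∈ C) (sym u≡x) x∈C))

  complete-⊆-simplicial-clique : ∀ {s C B} → Simplicial G s → IsClique G C → s ∈ C →
                                 Complete G B → s ∈ B → B ⊆ C
  complete-⊆-simplicial-clique {s} simp clique s∈C complete s∈B {u} u∈B with u ≟ s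
  ... | yes refl = s∈C
  ... | no  u≢s  = simplicial-neighbour∈clique simp clique s∈C
                     (complete s u s∈B u∈B (u≢s ∘ sym))

  simplicial-clique-unique : ∀ {s C₁ C₂} → Simplicial G s → IsClique G C₁ → IsClique G C₂ →
                             s ∈ C₁ → s ∈ C₂ → C₁ ≡ C₂
  simplicial-clique-unique simp clique₁ clique₂ s∈C₁ s∈C₂ = ⊆-antisym
    (complete-⊆-simplicial-clique simp clique₂ s∈C₂ (proj₁ clique₁) s∈C₁)
    (complete-⊆-simplicial-clique simp clique₁ s∈C₁ (proj₁ clique₂) s∈C₂)

  simplicial-independent-neighbour-unique : ∀ {s S u w} → Simplicial G s → Independent G S →
                                            u ∈ S → w ∈ S → Adj s u → Adj s w → u ≡ w
  simplicial-independent-neighbour-unique {u = u} {w} simp indS u∈S w∈S s~u s~w with u ≟ w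
  ... | yes u≡w = u≡w
  ... | no  u≢w = contradiction (simp u w s~u s~w u≢w) (indS u w u∈S w∈S)

  two-for-one⇒¬IsAlphaSet : ∀ {S v a b} → Independent G S → v ∈ S → a ∉ S → b ∉ S →
                            a ≢ b → ¬ Adj a b →
                            (∀ {u} → u ∈ S → Adj a u → u ≡ v) →
                            (∀ {u} → u ∈ S → Adj b u → u ≡ v) →
                            ¬ IsAlphaSet G S
  two-for-one⇒¬IsAlphaSet {S} {v} {a} {b} indS v∈S a∉S b∉S a≢b a≁b a~S⇒v b~S⇒v (_ , maxS) =
    <⇒≱ ∣S∣<∣T∣ (maxS T indT)
    where
    S⁻ = S - v
    S⁻a = S⁻ ∪ ⁅ a ⁆
    T = S⁻a ∪ ⁅ b ⁆

    S⁻⊆S : S⁻ ⊆ S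
    S⁻⊆S = p─q⊆p S ⁅ v ⁆

    a≁S⁻ : ∀ {u} → u ∈ S⁻ → ¬ Adj a u
    a≁S⁻ u∈S⁻ = x∈p-y⇒x≢y u∈S⁻ ∘ a~S⇒v (S⁻⊆S u∈S⁻)

    b≁S⁻a : ∀ {u} → u ∈ S⁻a → ¬ Adj b u
    b≁S⁻a u∈S⁻a with x∈p∪q⁻ S⁻ ⁅ a ⁆ u∈S⁻a
    ... | inj₁ u∈S⁻ = x∈p-y⇒x≢y u∈S⁻ ∘ b~S⇒v (S⁻⊆S u∈S⁻)
    ... | inj₂ u∈⁅a⁆ rewrite x∈⁅y⁆⇒x≡y a u∈⁅a⁆ = a≁b ∘ symmetric

    b∉S⁻a : b ∉ S⁻a
    b∉S⁻a b∈S⁻a with x∈p∪q⁻ S⁻ ⁅ a ⁆ b∈S⁻a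
    ... | inj₁ b∈S⁻ = b∉S (S⁻⊆S b∈S⁻)
    ... | inj₂ b∈⁅a⁆ = a≢b (sym (x∈⁅y⁆⇒x≡y a b∈⁅a⁆))

    indT : Independent G T
    indT = independent-∪-⁅⁆ (independent-∪-⁅⁆ (independent-⊆ S⁻⊆S indS) a≁S⁻) b≁S⁻a

    ∣S∣<∣T∣ : ∣ S ∣ < ∣ T ∣
    ∣S∣<∣T∣ = ≤-<-trans
      (≤-trans (≤-reflexive (x∈p⇒∣p∣≡suc∣p-x∣ v∈S)) (p⊂q⇒∣p∣<∣q∣ (x∉p⇒p⊂p∪⁅x⁆ (a∉S ∘ S⁻⊆S))))
      (p⊂q⇒∣p∣<∣q∣ (x∉p⇒p⊂p∪⁅x⁆ b∉S⁻a))

  simplicial-common-neighbour∉α-set : ∀ {s₁ s₂ v S} → Simplicial G s₁ → Simplicial G s₂ →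
                                      s₁ ≢ s₂ → ¬ Adj s₁ s₂ → Adj s₁ v → Adj s₂ v →
                                      IsAlphaSet G S → v ∉ S
  simplicial-common-neighbour∉α-set {v = v} {S} simp₁ simp₂ s₁≢s₂ s₁≁s₂ s₁~v s₂~v α@(indS , _) v∈S =
    two-for-one⇒¬IsAlphaSet indS v∈S (neighbour∉S s₁~v) (neighbour∉S s₂~v) s₁≢s₂ s₁≁s₂
      (only-neighbour simp₁ s₁~v) (only-neighbour simp₂ s₂~v) α
    where
    neighbour∉S : ∀ {s} → Adj s v → s ∉ S
    neighbour∉S s~v s∈S = indS _ v s∈S v∈S s~v

    only-neighbour : ∀ {s u} → Simplicial G s → Adj s v → u ∈ S → Adj s u → u ≡ v
    only-neighbour simp s~v u∈S s~u =
      simplicial-independent-neighbour-unique simp indS u∈S v∈S s~u s~v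

proposition1 : {n : ℕ} (G : Graph n) → AlphaExcellent G →
    ∀ (v : Fin n) (C₁ C₂ : Subset n) → IsSimplex G C₁ → IsSimplex G C₂ →
    v ∈ C₁ → v ∈ C₂ → C₁ ≡ C₂
proposition1 G exc v C₁ C₂ (clique₁ , s₁ , s₁∈C₁ , simp₁) (clique₂ , s₂ , s₂∈C₂ , simp₂) v∈C₁ v∈C₂
  with s₁ ∈? C₂ | s₂ ∈? C₁
... | yes s₁∈C₂ | _         = simplicial-clique-unique G simp₁ clique₁ clique₂ s₁∈C₁ s₁∈C₂
... | no _      | yes s₂∈C₁ = simplicial-clique-unique G simp₂ clique₁ clique₂ s₂∈C₁ s₂∈C₂
... | no s₁∉C₂  | no s₂∉C₁  =
  let (S , α , v∈S) = exc v in
  contradiction v∈S (simplicial-common-neighbour∉α-set G simp₁ simp₂ s₁≢s₂ s₁≁s₂ s₁~v s₂~v α)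
  where
  s₁≢s₂ : s₁ ≢ s₂
  s₁≢s₂ refl = s₁∉C₂ s₂∈C₂
  s₁≁s₂ : ¬ Graph.Adj G s₁ s₂
  s₁≁s₂ = s₂∉C₁ ∘ simplicial-neighbour∈clique G simp₁ clique₁ s₁∈C₁
  s₁~v : Graph.Adj G s₁ v
  s₁~v = proj₁ clique₁ s₁ v s₁∈C₁ v∈C₁ λ { refl → s₁∉C₂ v∈C₂ }
  s₂~v : Graph.Adj G s₂ v
  s₂~v = proj₁ clique₂ s₂ v s₂∈C₂ v∈C₂ λ { refl → s₂∉C₁ v∈C₁ }
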